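{- Let $n\ge4$ and let $S$ be an inductive strategy of length $n$ with $S[n]\neq[2,3,\dots,n,1]$ (i.e. $S\neq CS$). Then the number of permutations $\pi\in S_n$ such that the game with strategy $S$ and secret $\pi$ ends after exactly three guesses and $\rho_S(\pi)=2$ is strictly less than $2^n-2n-2$.
   Context: Permutation wordle on $[n]=\{1,\dots,n\}$: a secret permutation $\pi\in S_n$ (one-line notation) is fixed. The first guess is $\gamma_1=[1,2,\dots,n]$. After guess $\gamma_r$ the guesser learns $\mathcal{J}_r=\{i:\gamma_r(i)=\pi(i)\}$; $\mathcal{I}_r=[n]\setminus\mathcal{J}_r$. The game ends at the first $r$ with $\mathcal{J}_r=[n]$. A strategy of length $n$ is a sequence $S=(S[1],\dots,S[n])$ with $S[k]$ a permutation of $[k]$; if $\mathcal{I}_r=\{i_1<\dots<i_k\}\neq\emptyset$ and $\sigma=S[k]$, then $\gamma_{r+1}(i)=\gamma_r(i)$ for $i\in\mathcal{J}_r$ and $\gamma_{r+1}(i_{\sigma(j)})=\gamma_r(i_j)$ for $j=1,\dots,k$. The cyclic shift strategy $CS$ has $CS[k]=[2,3,\dots,k,1]$. An inductive strategy of length $n$ has $S[k]=CS[k]$ for $1\le k\le n-1$ and $S[n]$ an arbitrary cyclic permutation (single $n$-cycle) of $[n]$. For a secret $\pi$, $\rho_S(\pi)=\min\{i:\mathcal{J}_i\neq\emptyset\}$. -}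

module Defs where

open import Data.Nat using (ℕ; zero; suc; _<_; _≤_)
open import Data.Fin as Fin using (Fin; zero; suc)
open import Data.Fin.Properties using () renaming (_≟_ to _≟ᶠ_)
open import Data.Vec as Vec using (Vec; []; _∷_; lookup; allFin; _∷ʳ_; _[_]≔_; toList; fromList)
open import Data.Vec.Properties using () renaming (≡-dec to ≡-decᵛ)
open import Data.List as List using (List; []; _∷_; length; filter; concatMap)
open import Data.List.Properties using () renaming (≡-dec to ≡-decˡ)
open import Data.List.Relation.Unary.Unique.Propositional using (Unique)
import Data.List.Relation.Unary.Unique.DecPropositional as UDec
open import Data.Product using (_×_; ∃)
open import Relation.Nullary using (¬_; Dec; ¬?; _×-dec_)
open import Relation.Binary.PropositionalEquality using (_≡_)
open import Function using (_∘_)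

-- Conventions: [n] is represented by Fin n (0-based: value/position i
-- stands for i+1).  A permutation / guess in one-line notation is a
-- vector v : Vec (Fin n) n, v[i] being the image of i.

IsPerm : ∀ {n} → Vec (Fin n) n → Set
IsPerm v = Unique (toList v)

isPerm? : ∀ {n} (v : Vec (Fin n) n) → Dec (IsPerm v)
isPerm? {n} v = UDec.unique? (_≟ᶠ_ {n}) (toList v)

iter : ∀ {n} → Vec (Fin n) n → ℕ → Fin n → Fin n
iter σ zero    i = i
iter σ (suc k) i = lookup σ (iter σ k i)

IsCyclic : ∀ {n} → Vec (Fin n) n → Set
IsCyclic {n} σ = IsPerm σ × (∀ (i j : Fin n) → ∃ λ k → iter σ k i ≡ j)

CS : (k : ℕ) → Vec (Fin k) k
CS zero    = []
CS (suc k) = Vec.map suc (allFin k) ∷ʳ zero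

-- a strategy: S k is a permutation of [k] (only 1 ≤ k ≤ n are ever used)
Strategy : Set
Strategy = (k : ℕ) → Vec (Fin k) k

γ₁ : (n : ℕ) → Vec (Fin n) n
γ₁ n = allFin n

J : ∀ {n} → Vec (Fin n) n → Vec (Fin n) n → List (Fin n)
J {n} γ π = filter (λ i → lookup γ i ≟ᶠ lookup π i) (toList (allFin n))

I : ∀ {n} → Vec (Fin n) n → Vec (Fin n) n → List (Fin n)
I {n} γ π = filter (λ i → ¬? (lookup γ i ≟ᶠ lookup π i)) (toList (allFin n))

-- next guess: keep positions in J; with I = {i₁<…<i_k}, σ = S[k]:
-- γ'(i_{σ(j)}) = γ(i_j) for j = 1..k.
nextGuess : ∀ {n} → Strategy → Vec (Fin n) n → Vec (Fin n) n → Vec (Fin n) n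
nextGuess {n} S π γ = List.foldl upd γ (toList (allFin k))
  where
  Is : List (Fin n)
  Is = I γ π
  k : ℕ
  k = length Is
  iv : Vec (Fin n) k
  iv = fromList Is
  σ : Vec (Fin k) k
  σ = S k
  upd : Vec (Fin n) n → Fin k → Vec (Fin n) n
  upd acc j = acc [ lookup iv (lookup σ j) ]≔ lookup γ (lookup iv j)

γ₂ γ₃ : ∀ {n} → Strategy → Vec (Fin n) n → Vec (Fin n) n
γ₂ {n} S π = nextGuess S π (γ₁ n)
γ₃ S π = nextGuess S π (γ₂ S π)

-- the game with strategy S and secret π ends after exactly three guesses
-- (J₃ = [n], J₁ ≠ [n], J₂ ≠ [n]) and ρ_S(π) = 2 (J₁ = ∅, J₂ ≠ ∅).
Good : ∀ {n} → Strategy → Vec (Fin n) n → Set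
Good {n} S π =
  (¬ (J (γ₁ n) π ≡ toList (allFin n))) ×
  (¬ (J (γ₂ S π) π ≡ toList (allFin n))) ×
  (J (γ₃ S π) π ≡ toList (allFin n)) ×
  (J (γ₁ n) π ≡ []) ×
  (¬ (J (γ₂ S π) π ≡ []))

good? : ∀ {n} (S : Strategy) (π : Vec (Fin n) n) → Dec (Good S π)
good? {n} S π =
  ¬? (≡-decˡ _≟ᶠ_ _ _) ×-dec ¬? (≡-decˡ _≟ᶠ_ _ _) ×-dec ≡-decˡ _≟ᶠ_ _ _
    ×-dec ≡-decˡ _≟ᶠ_ _ _ ×-dec ¬? (≡-decˡ _≟ᶠ_ _ _)

allVecs : (n m : ℕ) → List (Vec (Fin n) m)
allVecs n zero    = [] ∷ []
allVecs n (suc m) = concatMap (λ x → List.map (x ∷_) (allVecs n m)) (toList (allFin n))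

allPerms : (n : ℕ) → List (Vec (Fin n) n)
allPerms n = filter isPerm? (allVecs n n)

countGood : (n : ℕ) → Strategy → ℕ
countGood n S = length (filter (good? S) (allPerms n))

IsInductive : ℕ → Strategy → Set
IsInductive n S = (∀ k → 1 ≤ k → k < n → S k ≡ CS k) × IsCyclic (S n)

-- If ρ(π) = 2 then π is a derangement, so the first guess rearranges all of [n] by σ = S[n] and the second
-- guess is σ⁻¹ whatever π is.  The third guess equals π and is obtained from σ⁻¹ and the set I₂ of positions
-- where the second guess is wrong, so π ↦ I₂ is injective on the permutations counted.  Now I₂ is neither ∅
-- nor [n], and not a singleton (S[1] fixes it).  Since S[2] and S[3] are cyclic shifts, π(y) = σ⁻¹(x) for
-- cyclically consecutive x, y in I₂, so if σ(y) = x then y is a fixed point of π; this excludes the n pairs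
-- {b, σ b}, which are distinct because the n-cycle σ has no 2-cycle (n ≥ 3), and, as σ ≠ CS, one triple.
-- Hence at most 2ⁿ − (2n + 3) subsets remain.

module Submission where

open import Defs
open import Data.Nat using (ℕ; _≤_; _<_; _∸_; _*_; _^_)
open import Data.Product using (_×_)
open import Relation.Nullary using (¬_)
open import Relation.Binary.PropositionalEquality using (_≡_)

open import Data.Nat as ℕ using (zero; suc; _+_; z≤n; s≤s)
import Data.Nat.Properties as ℕ
open import Data.Nat.Tactic.RingSolver using (solve-∀)
open import Data.Fin as Fin using (Fin; zero; suc; toℕ)
import Data.Fin.Properties as Fin
open import Data.List as List using (List; []; _∷_; length; filter; map; _++_; cartesianProductWith; concatMap)
import Data.List.Properties as List
open import Data.List.Relation.Unary.All as All using (All; []; _∷_)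
import Data.List.Relation.Unary.All.Properties as All
open import Data.List.Relation.Unary.Any as Any using (here; there; _─_)
open import Data.List.Relation.Unary.AllPairs using (AllPairs; []; _∷_)
import Data.List.Relation.Unary.AllPairs.Properties as AllPairs
open import Data.List.Relation.Unary.Unique.Propositional using (Unique)
import Data.List.Relation.Unary.Unique.Propositional.Properties as Unique
open import Data.List.Membership.Propositional using (_∈_; _∉_)
import Data.List.Membership.Propositional.Properties as ∈
open import Data.List.Relation.Binary.Sublist.Propositional using (_⊆_; []; _∷_; _∷ʳ_)
open import Data.List.Relation.Binary.Sublist.Propositional.Properties using ([]⊆-universal; filter-⊆)
open import Data.Vec as Vec using (Vec; []; _∷_; lookup; allFin; toList; fromList; _[_]≔_)
import Data.Vec.Properties as Vec
import Data.Vec.Membership.Propositional.Properties as ∈ᵛ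
open import Data.Product using (_,_; proj₁; proj₂; ∃₂)
open import Data.Sum using (_⊎_; inj₁; inj₂; [_,_]′)
open import Data.Empty using (⊥; ⊥-elim)
open import Function using (id; _∘_; _∘′_; case_of_)
open import Function.Definitions using (Injective)
open import Relation.Nullary using (yes; no)
open import Relation.Nullary.Decidable using (decidable-stable)
open import Level using (Level)
open import Relation.Unary using (Pred; Decidable; ∁)
open import Relation.Unary.Properties using (∁?)
open import Relation.Binary using (Rel; IsStrictPartialOrder; tri<; tri≈; tri>)
open import Relation.Binary.PropositionalEquality hiding (J)

private
  variable
    ℓ : Level
    A B C : Set
    P : Pred A ℓ

sublists : List A → List (List A)
sublists []       = [] ∷ []
sublists (x ∷ xs) = map (x ∷_) (sublists xs) ++ sublists xs

length-sublists : (xs : List A) → length (sublists xs) ≡ 2 ^ length xs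
length-sublists []       = refl
length-sublists (x ∷ xs) = begin
  length (map (x ∷_) (sublists xs) ++ sublists xs)   ≡⟨ List.length-++ (map (x ∷_) (sublists xs)) ⟩
  length (map (x ∷_) (sublists xs)) + length (sublists xs)
                                                      ≡⟨ cong (_+ length (sublists xs)) (List.length-map (x ∷_) (sublists xs)) ⟩
  length (sublists xs) + length (sublists xs)         ≡⟨ cong (λ m → m + m) (length-sublists xs) ⟩
  2 ^ length xs + 2 ^ length xs                       ≡⟨ cong (2 ^ length xs +_) (ℕ.+-identityʳ (2 ^ length xs)) ⟨
  2 ^ suc (length xs)                                 ∎
  where open ≡-Reasoning

⊆⇒∈-sublists : {xs ys : List A} → xs ⊆ ys → xs ∈ sublists ys
⊆⇒∈-sublists []             = here refl
⊆⇒∈-sublists (y ∷ʳ xs⊆ys)   = ∈.∈-++⁺ʳ _ (⊆⇒∈-sublists xs⊆ys)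
⊆⇒∈-sublists (refl ∷ xs⊆ys) = ∈.∈-++⁺ˡ (∈.∈-map⁺ _ (⊆⇒∈-sublists xs⊆ys))

module _ {ℓ} {_<_ : Rel A ℓ} (<-isStrictPartialOrder : IsStrictPartialOrder _≡_ _<_) where
  open IsStrictPartialOrder <-isStrictPartialOrder using (irrefl) renaming (trans to <-trans)

  sorted-⊆ : {xs ys : List A} → AllPairs _<_ xs → AllPairs _<_ ys → All (_∈ ys) xs → xs ⊆ ys
  sorted-⊆ {[]}     {ys}     _              _              _                 = []⊆-universal ys
  sorted-⊆ {x ∷ xs} {y ∷ ys} (x<xs ∷ xs<<)  (y<ys ∷ ys<<)  (here refl ∷ xs∈) =
    refl ∷ sorted-⊆ xs<< ys<< (All.zipWith (λ (x<w , w∈) → later x<w w∈) (x<xs , xs∈))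
    where
    later : ∀ {w} → x < w → w ∈ x ∷ ys → w ∈ ys
    later x<w (here refl) = ⊥-elim (irrefl refl x<w)
    later x<w (there w∈)  = w∈
  sorted-⊆ {x ∷ xs} {y ∷ ys} (x<xs ∷ xs<<)  (y<ys ∷ ys<<)  (there x∈ ∷ xs∈)  =
    y ∷ʳ sorted-⊆ (x<xs ∷ xs<<) ys<< (x∈ ∷ All.zipWith (λ (x<w , w∈) → later x<w w∈) (x<xs , xs∈))
    where
    later : ∀ {w} → x < w → w ∈ y ∷ ys → w ∈ ys
    later x<w (here refl) = ⊥-elim (irrefl refl (<-trans (All.lookup y<ys x∈) x<w))
    later x<w (there w∈)  = w∈

∈-─⁺ : {x y : A} {ys : List A} (x∈ys : x ∈ ys) → y ∈ ys → y ≢ x → y ∈ (ys ─ x∈ys)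
∈-─⁺ (here refl) (here refl) y≢x = ⊥-elim (y≢x refl)
∈-─⁺ (here refl) (there y∈)  _   = y∈
∈-─⁺ (there x∈)  (here refl) _   = here refl
∈-─⁺ (there x∈)  (there y∈)  y≢x = there (∈-─⁺ x∈ y∈ y≢x)

unique⇒length-≤ : {xs ys : List A} → Unique xs → All (_∈ ys) xs → length xs ≤ length ys
unique⇒length-≤ {xs = []}     _           _            = z≤n
unique⇒length-≤ {xs = x ∷ xs} {ys} (x∉xs ∷ xs!) (x∈ys ∷ xs⊆ys) =
  subst (suc (length xs) ≤_) (sym (List.length-removeAt′ ys (Any.index x∈ys)))
    (s≤s (unique⇒length-≤ xs! (All.zipWith (λ (x≢w , w∈) → ∈-─⁺ x∈ys w∈ (x≢w ∘′ sym)) (x∉xs , xs⊆ys))))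

map⁺-injectiveOn : (f : A → B) {xs : List A} → Unique xs →
                   (∀ {a b} → a ∈ xs → b ∈ xs → f a ≡ f b → a ≡ b) → Unique (map f xs)
map⁺-injectiveOn f {[]}     _           _   = []
map⁺-injectiveOn f {x ∷ xs} (x∉xs ∷ xs!) inj =
  All.tabulate distinct ∷ map⁺-injectiveOn f xs! (λ a∈ b∈ → inj (there a∈) (there b∈))
  where
  distinct : ∀ {w} → w ∈ map f xs → f x ≢ w
  distinct w∈ fx≡w with ∈.∈-map⁻ f w∈
  ... | a , a∈ , refl = All.lookup x∉xs a∈ (inj (here refl) (there a∈) fx≡w)

concatMap-map≡cartesianProductWith : (f : A → B → C) (xs : List A) (ys : List B) →
  concatMap (λ x → map (f x) ys) xs ≡ cartesianProductWith f xs ys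
concatMap-map≡cartesianProductWith f []       ys = refl
concatMap-map≡cartesianProductWith f (x ∷ xs) ys = cong (map (f x) ys ++_) (concatMap-map≡cartesianProductWith f xs ys)

module _ {k n : ℕ} (pos : Fin k → Fin n) (val : Fin k → A) where
  private
    update : Vec A n → Fin k → Vec A n
    update acc j = acc [ pos j ]≔ val j

  lookup-foldl-update-∉ : ∀ acc js i → All (λ j → pos j ≢ i) js →
                          lookup (List.foldl update acc js) i ≡ lookup acc i
  lookup-foldl-update-∉ acc []       i _                = refl
  lookup-foldl-update-∉ acc (j ∷ js) i (posj≢i ∷ js≢i) =
    trans (lookup-foldl-update-∉ (update acc j) js i js≢i) (Vec.lookup∘update′ (posj≢i ∘ sym) acc (val j))

  lookup-foldl-update-∈ : Injective _≡_ _≡_ pos → ∀ acc {js j} → Unique js → j ∈ js →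
                          lookup (List.foldl update acc js) (pos j) ≡ val j
  lookup-foldl-update-∈ pos-inj acc {j ∷ js} (j∉js ∷ _) (here refl) =
    trans (lookup-foldl-update-∉ (update acc j) js (pos j) (All.map (λ j≢w posw≡posj → j≢w (sym (pos-inj posw≡posj))) j∉js))
          (Vec.lookup∘update (pos j) acc (val j))
  lookup-foldl-update-∈ pos-inj acc {w ∷ js} (_ ∷ js!) (there j∈js) =
    lookup-foldl-update-∈ pos-inj (update acc w) js! j∈js

lookup-injective : ∀ {m} (v : Vec A m) → Unique (toList v) → Injective _≡_ _≡_ (lookup v)
lookup-injective (x ∷ v) _          {zero}  {zero}  _ = refl
lookup-injective (x ∷ v) (x∉v ∷ _)  {zero}  {suc j} e = ⊥-elim (All.lookup x∉v (∈ᵛ.∈-toList⁺ (∈ᵛ.∈-lookup j v)) e)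
lookup-injective (x ∷ v) (x∉v ∷ _)  {suc i} {zero}  e =
  ⊥-elim (All.lookup x∉v (∈ᵛ.∈-toList⁺ (∈ᵛ.∈-lookup i v)) (sym e))
lookup-injective (x ∷ v) (_   ∷ v!) {suc i} {suc j} e = cong suc (lookup-injective v v! e)

fromList-lookup-injective : {xs : List A} → Unique xs → Injective _≡_ _≡_ (lookup (fromList xs))
fromList-lookup-injective {xs = xs} xs! = lookup-injective (fromList xs) (subst Unique (sym (Vec.toList∘fromList xs)) xs!)

lookup-ext : ∀ {m} {u v : Vec A m} → (∀ i → lookup u i ≡ lookup v i) → u ≡ v
lookup-ext {u = u} {v} u≗v = begin
  u                      ≡⟨ Vec.tabulate∘lookup u ⟨
  Vec.tabulate (lookup u) ≡⟨ Vec.tabulate-cong u≗v ⟩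
  Vec.tabulate (lookup v) ≡⟨ Vec.tabulate∘lookup v ⟩
  v                      ∎
  where open ≡-Reasoning

toList-tabulate : ∀ {m} (f : Fin m → A) → toList (Vec.tabulate f) ≡ List.tabulate f
toList-tabulate {m = zero}  f = refl
toList-tabulate {m = suc m} f = cong (f zero ∷_) (toList-tabulate (f ∘ suc))

positions : (n : ℕ) → List (Fin n)
positions n = toList (allFin n)

length-positions : (n : ℕ) → length (positions n) ≡ n
length-positions n = Vec.length-toList (allFin n)

∈-positions : ∀ {n} (i : Fin n) → i ∈ positions n
∈-positions i = subst (i ∈_) (sym (toList-tabulate id)) (∈.∈-allFin i)

positions-unique : (n : ℕ) → Unique (positions n)
positions-unique n = subst Unique (sym (toList-tabulate id)) (Unique.allFin⁺ n)

positions-sorted : (n : ℕ) → AllPairs Fin._<_ (positions n)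
positions-sorted n = subst (AllPairs Fin._<_) (sym (toList-tabulate id)) (AllPairs.tabulate⁺-< id)

lookup-fromList-positions : ∀ {n} (j : Fin (length (positions n))) →
                            lookup (fromList (positions n)) j ≡ Fin.cast (length-positions n) j
lookup-fromList-positions {n} j = begin
  lookup (fromList (positions n)) j
    ≡⟨ Vec.lookup-cast (length-positions n) (fromList (positions n)) j ⟨
  lookup (Vec.cast (length-positions n) (fromList (positions n))) (Fin.cast (length-positions n) j)
    ≡⟨ cong (λ v → lookup v (Fin.cast (length-positions n) j)) (Vec.fromList∘toList (allFin n)) ⟩
  lookup (allFin n) (Fin.cast (length-positions n) j)
    ≡⟨ Vec.lookup-allFin _ ⟩
  Fin.cast (length-positions n) j ∎
  where open ≡-Reasoning

allVecs-unique : ∀ n m → Unique (allVecs n m)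
allVecs-unique n zero    = [] ∷ []
allVecs-unique n (suc m) =
  subst Unique (sym (concatMap-map≡cartesianProductWith _∷_ (positions n) (allVecs n m)))
    (Unique.cartesianProductWith⁺ _∷_ Vec.∷-injective (positions-unique n) (allVecs-unique n m))

sorted⇒∈-sublists-positions : ∀ {n} {is : List (Fin n)} → AllPairs Fin._<_ is → is ∈ sublists (positions n)
sorted⇒∈-sublists-positions {n} is-sorted =
  ⊆⇒∈-sublists (sorted-⊆ Fin.<-isStrictPartialOrder is-sorted (positions-sorted n) (All.tabulate λ {i} _ → ∈-positions i))

filter≡[]⇒All∁ : (P? : Decidable P) → ∀ {xs} → filter P? xs ≡ [] → All (∁ P) xs
filter≡[]⇒All∁ P? e = All.tabulate λ x∈xs px → case subst (_ ∈_) e (∈.∈-filter⁺ P? x∈xs px) of λ ()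

filter≡id⇒All : (P? : Decidable P) → ∀ {xs} → filter P? xs ≡ xs → All P xs
filter≡id⇒All P? {xs} e = All.tabulate λ x∈xs → proj₂ (∈.∈-filter⁻ P? {xs = xs} (subst (_ ∈_) (sym e) x∈xs))

filter≡[]⇒filter-∁≡id : (P? : Decidable P) → ∀ {xs} → filter P? xs ≡ [] → filter (∁? P?) xs ≡ xs
filter≡[]⇒filter-∁≡id P? e = List.filter-all (∁? P?) (filter≡[]⇒All∁ P? e)

filter-∁≡[]⇒filter≡id : (P? : Decidable P) → ∀ {xs} → filter (∁? P?) xs ≡ [] → filter P? xs ≡ xs
filter-∁≡[]⇒filter≡id P? e = List.filter-all P? (All.map (decidable-stable (P? _)) (filter≡[]⇒All∁ (∁? P?) e))

filter-∁≡id⇒filter≡[] : (P? : Decidable P) → ∀ {xs} → filter (∁? P?) xs ≡ xs → filter P? xs ≡ []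
filter-∁≡id⇒filter≡[] P? e = List.filter-none P? (filter≡id⇒All (∁? P?) e)

-- nextGuess S π γ unfolds to rearrange S γ (I γ π).
rearrange : ∀ {n} → Strategy → Vec (Fin n) n → List (Fin n) → Vec (Fin n) n
rearrange {n} S γ is = List.foldl move γ (positions (length is))
  where
  move : Vec (Fin n) n → Fin (length is) → Vec (Fin n) n
  move acc j = acc [ lookup (fromList is) (lookup (S (length is)) j) ]≔ lookup γ (lookup (fromList is) j)

lookup-rearrange : ∀ {n} (S : Strategy) (γ : Vec (Fin n) n) {is : List (Fin n)} → Unique is →
                   Injective _≡_ _≡_ (lookup (S (length is))) → ∀ j →
                   lookup (rearrange S γ is) (lookup (fromList is) (lookup (S (length is)) j))
                     ≡ lookup γ (lookup (fromList is) j)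
lookup-rearrange S γ {is} is! σ-inj j =
  lookup-foldl-update-∈ (λ j → lookup (fromList is) (lookup (S (length is)) j)) (λ j → lookup γ (lookup (fromList is) j))
    (σ-inj ∘ fromList-lookup-injective is!) γ (positions-unique _) (∈-positions j)

lookup-rearrange-positions : ∀ {n} (S : Strategy) (γ : Vec (Fin n) n) → Injective _≡_ _≡_ (lookup (S n)) → ∀ t →
                             lookup (rearrange S γ (positions n)) (lookup (S n) t) ≡ lookup γ t
lookup-rearrange-positions {n} S γ σ-inj =
  untransport (length-positions n) (fromList (positions n)) lookup-fromList-positions
    (lookup-rearrange S γ (positions-unique n) (subst (λ k → Injective _≡_ _≡_ (lookup (S k))) (sym (length-positions n)) σ-inj))
  where
  G : Vec (Fin n) n
  G = rearrange S γ (positions n)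
  -- S is indexed by the list length, which is n only propositionally.
  untransport : ∀ {k} (e : k ≡ n) (idx : Vec (Fin n) k) → (∀ j → lookup idx j ≡ Fin.cast e j) →
                (∀ j → lookup G (lookup idx (lookup (S k) j)) ≡ lookup γ (lookup idx j)) →
                ∀ t → lookup G (lookup (S n) t) ≡ lookup γ t
  untransport refl idx idx≡cast moved t =
    subst₂ (λ u v → lookup G u ≡ lookup γ v) (idx≡id (lookup (S _) t)) (idx≡id t) (moved t)
    where
    idx≡id : ∀ j → lookup idx j ≡ j
    idx≡id j = trans (idx≡cast j) (Fin.cast-is-id refl j)

module _ {n} {σ : Vec (Fin n) n} (σ-cyclic : IsCyclic σ) (3≤n : 3 ≤ n) where

  cyclic⇒no-2-cycle : ∀ b → lookup σ (lookup σ b) ≢ b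
  cyclic⇒no-2-cycle b σσb≡b = ℕ.<-irrefl refl (ℕ.≤-trans 3≤n n≤2)
    where
    orbit : ∀ k → iter σ k b ∈ b ∷ lookup σ b ∷ []
    orbit zero = here refl
    orbit (suc k) with orbit k
    ... | here e         = there (here (cong (lookup σ) e))
    ... | there (here e) = here (trans (cong (lookup σ) e) σσb≡b)
    n≤2 : n ≤ 2
    n≤2 = subst (_≤ 2) (length-positions n)
            (unique⇒length-≤ (positions-unique n)
              (All.tabulate λ {j} _ → let k , σᵏb≡j = proj₂ σ-cyclic b j in subst (_∈ _) σᵏb≡j (orbit k)))

  cyclic⇒no-fixpoint : ∀ b → lookup σ b ≢ b
  cyclic⇒no-fixpoint b σb≡b = cyclic⇒no-2-cycle b (trans (cong (lookup σ) σb≡b) σb≡b)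

lookup-∷ʳ-< : ∀ {m} (xs : Vec A m) x (b : Fin (suc m)) (b<m : toℕ b < m) →
              lookup (xs Vec.∷ʳ x) b ≡ lookup xs (Fin.fromℕ< b<m)
lookup-∷ʳ-< (y ∷ xs) x zero    _           = refl
lookup-∷ʳ-< (y ∷ xs) x (suc b) (s≤s b<m) = lookup-∷ʳ-< xs x b b<m

lookup-∷ʳ-last : ∀ {m} (xs : Vec A m) x (b : Fin (suc m)) → toℕ b ≡ m → lookup (xs Vec.∷ʳ x) b ≡ x
lookup-∷ʳ-last []       x zero    _   = refl
lookup-∷ʳ-last (y ∷ xs) x (suc b) b≡m = lookup-∷ʳ-last xs x b (ℕ.suc-injective b≡m)

toℕ-lookup-CS-< : ∀ {n} (b : Fin n) → suc (toℕ b) < n → toℕ (lookup (CS n) b) ≡ suc (toℕ b)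
toℕ-lookup-CS-< {suc m} b (s≤s b<m) = begin
  toℕ (lookup (Vec.map suc (allFin m) Vec.∷ʳ zero) b)  ≡⟨ cong toℕ (lookup-∷ʳ-< (Vec.map suc (allFin m)) zero b b<m) ⟩
  toℕ (lookup (Vec.map suc (allFin m)) (Fin.fromℕ< b<m)) ≡⟨ cong toℕ (Vec.lookup-map (Fin.fromℕ< b<m) suc (allFin m)) ⟩
  suc (toℕ (lookup (allFin m) (Fin.fromℕ< b<m)))        ≡⟨ cong (suc ∘ toℕ) (Vec.lookup-allFin (Fin.fromℕ< b<m)) ⟩
  suc (toℕ (Fin.fromℕ< b<m))                            ≡⟨ cong suc (Fin.toℕ-fromℕ< b<m) ⟩
  suc (toℕ b)                                           ∎
  where open ≡-Reasoning

toℕ-lookup-CS-last : ∀ {n} (b : Fin n) → suc (toℕ b) ≡ n → toℕ (lookup (CS n) b) ≡ 0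
toℕ-lookup-CS-last {suc m} b b+1≡n = cong toℕ (lookup-∷ʳ-last (Vec.map suc (allFin m)) zero b (ℕ.suc-injective b+1≡n))

CS₂-injective : Injective _≡_ _≡_ (lookup (CS 2))
CS₂-injective = lookup-injective (CS 2) (((λ ()) ∷ []) ∷ [] ∷ [])

CS₃-injective : Injective _≡_ _≡_ (lookup (CS 3))
CS₃-injective = lookup-injective (CS 3) (((λ ()) ∷ (λ ()) ∷ []) ∷ ((λ ()) ∷ []) ∷ [] ∷ [])

<-fromℕ<-suc : ∀ {n} (b : Fin n) (1+b<n : suc (toℕ b) < n) → b Fin.< Fin.fromℕ< 1+b<n
<-fromℕ<-suc b 1+b<n = subst (toℕ b <_) (sym (Fin.toℕ-fromℕ< 1+b<n)) (ℕ.n<1+n (toℕ b))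

-- σ reverses one step of the cyclic order x → y → z → x.
record BackwardTriple {n} (σ : Fin n → Fin n) : Set where
  field
    x y z    : Fin n
    x<y      : x Fin.< y
    y<z      : y Fin.< z
    backward : σ y ≡ x ⊎ σ z ≡ y ⊎ σ x ≡ z

-- σ b differs from CS b = b + 1 (mod n) for some b; the triple is {b, b + 1, σ b}, {σ b, b, b + 1} or {0, σ b, b}.
≢CS⇒backwardTriple : ∀ {n} {σ : Vec (Fin n) n} → IsCyclic σ → 3 ≤ n → σ ≢ CS n → BackwardTriple (lookup σ)
≢CS⇒backwardTriple {n} {σ} σ-cyclic 3≤n σ≢CS
  with b , σb≢CSb ← Fin.¬∀⟶∃¬ n _ (λ b → lookup σ b Fin.≟ lookup (CS n) b) (σ≢CS ∘ lookup-ext)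
  with Fin.<-cmp (lookup σ b) b
... | tri≈ _ σb≡b _ = ⊥-elim (cyclic⇒no-fixpoint σ-cyclic 3≤n b σb≡b)
... | tri> _ _ b<σb = record
  { x = b ; y = Fin.fromℕ< 1+b<n ; z = lookup σ b ; x<y = <-fromℕ<-suc b 1+b<n ; y<z = 1+b<σb ; backward = inj₂ (inj₂ refl) }
  where
  1+b<n : suc (toℕ b) < n
  1+b<n = ℕ.≤-trans (s≤s b<σb) (Fin.toℕ<n (lookup σ b))
  1+b<σb : Fin.fromℕ< 1+b<n Fin.< lookup σ b
  1+b<σb = subst (_< toℕ (lookup σ b)) (sym (Fin.toℕ-fromℕ< 1+b<n))
             (ℕ.≤∧≢⇒< b<σb (λ 1+b≡σb → σb≢CSb (Fin.toℕ-injective (trans (sym 1+b≡σb) (sym (toℕ-lookup-CS-< b 1+b<n))))))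
... | tri< σb<b _ _ with toℕ (lookup σ b) ℕ.≟ 0
...   | yes σb≡0 = record
  { x = lookup σ b ; y = b ; z = Fin.fromℕ< 1+b<n ; x<y = σb<b ; y<z = <-fromℕ<-suc b 1+b<n ; backward = inj₁ refl }
  where
  1+b<n : suc (toℕ b) < n
  1+b<n = ℕ.≤∧≢⇒< (Fin.toℕ<n b) (λ 1+b≡n → σb≢CSb (Fin.toℕ-injective (trans σb≡0 (sym (toℕ-lookup-CS-last b 1+b≡n)))))
...   | no σb≢0 = record
  { x = Fin.fromℕ< 0<n ; y = lookup σ b ; z = b ; x<y = 0<σb ; y<z = σb<b ; backward = inj₂ (inj₁ refl) }
  where
  0<n : 0 < n
  0<n = ℕ.≤-trans (s≤s z≤n) 3≤n
  0<σb : Fin.fromℕ< 0<n Fin.< lookup σ b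
  0<σb = subst (_< toℕ (lookup σ b)) (sym (Fin.toℕ-fromℕ< 0<n)) (ℕ.n≢0⇒n>0 σb≢0)

matches? : ∀ {n} (γ π : Vec (Fin n) n) → Decidable (λ i → lookup γ i ≡ lookup π i)
matches? γ π i = lookup γ i Fin.≟ lookup π i

-- The second guess against any derangement: the first guess is entirely wrong, so all of [n] is rearranged by S[n].
γ₂ᵈ : ∀ {n} → Strategy → Vec (Fin n) n
γ₂ᵈ {n} S = rearrange S (allFin n) (positions n)

γ₂ᵈ-inverse : ∀ {n} (S : Strategy) → Injective _≡_ _≡_ (lookup (S n)) → ∀ t → lookup (γ₂ᵈ S) (lookup (S n) t) ≡ t
γ₂ᵈ-inverse S σ-inj t = trans (lookup-rearrange-positions S (allFin _) σ-inj t) (Vec.lookup-allFin t)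

module GoodSecret {n} (S : Strategy) (σ-inj : Injective _≡_ _≡_ (lookup (S n))) {π : Vec (Fin n) n} (good : Good S π) where
  private
    J₂≢all : J (γ₂ S π) π ≢ positions n
    J₂≢all = proj₁ (proj₂ good)
    J₃≡all : J (γ₃ S π) π ≡ positions n
    J₃≡all = proj₁ (proj₂ (proj₂ good))
    J₁≡[] : J (γ₁ n) π ≡ []
    J₁≡[] = proj₁ (proj₂ (proj₂ (proj₂ good)))
    J₂≢[] : J (γ₂ S π) π ≢ []
    J₂≢[] = proj₂ (proj₂ (proj₂ (proj₂ good)))

  derangement : ∀ i → lookup π i ≢ i
  derangement i πi≡i = All.lookup (filter≡[]⇒All∁ (matches? (allFin n) π) J₁≡[]) (∈-positions i)
                         (trans (Vec.lookup-allFin i) (sym πi≡i))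

  γ₂≡γ₂ᵈ : γ₂ S π ≡ γ₂ᵈ S
  γ₂≡γ₂ᵈ = cong (rearrange S (allFin n)) (filter≡[]⇒filter-∁≡id (matches? (allFin n) π) {positions n} J₁≡[])

  I₂ : List (Fin n)
  I₂ = I (γ₂ᵈ S) π

  π≡rearrange : π ≡ rearrange S (γ₂ᵈ S) I₂
  π≡rearrange = begin
    π                      ≡⟨ lookup-ext (All.lookup (filter≡id⇒All (matches? (γ₃ S π) π) J₃≡all) ∘ ∈-positions) ⟨
    γ₃ S π                 ≡⟨ cong (λ γ → rearrange S γ (I γ π)) γ₂≡γ₂ᵈ ⟩
    rearrange S (γ₂ᵈ S) I₂ ∎
    where open ≡-Reasoning

  I₂≢[] : I₂ ≢ []
  I₂≢[] I₂≡[] = J₂≢all (subst (λ γ → J γ π ≡ positions n) (sym γ₂≡γ₂ᵈ)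
                                (filter-∁≡[]⇒filter≡id (matches? (γ₂ᵈ S) π) I₂≡[]))

  I₂≢positions : I₂ ≢ positions n
  I₂≢positions I₂≡all = J₂≢[] (subst (λ γ → J γ π ≡ []) (sym γ₂≡γ₂ᵈ)
                                      (filter-∁≡id⇒filter≡[] (matches? (γ₂ᵈ S) π) I₂≡all))

  I₂-unique : Unique I₂
  I₂-unique = Unique.filter⁺ (∁? (matches? (γ₂ᵈ S) π)) (positions-unique n)

  ∈I₂⇒mismatch : ∀ {i} → i ∈ I₂ → lookup (γ₂ᵈ S) i ≢ lookup π i
  ∈I₂⇒mismatch i∈I₂ = proj₂ (∈.∈-filter⁻ (∁? (matches? (γ₂ᵈ S) π)) {xs = positions n} i∈I₂)

  shifted : ∀ {is} → I₂ ≡ is → Injective _≡_ _≡_ (lookup (S (length is))) → ∀ j →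
            lookup π (lookup (fromList is) (lookup (S (length is)) j)) ≡ lookup (γ₂ᵈ S) (lookup (fromList is) j)
  shifted refl τ-inj j =
    trans (cong (λ v → lookup v (lookup (fromList I₂) (lookup (S (length I₂)) j))) π≡rearrange)
          (lookup-rearrange S (γ₂ᵈ S) I₂-unique τ-inj j)

  cyclically-shifted : ∀ {is} → I₂ ≡ is → S (length is) ≡ CS (length is) → Injective _≡_ _≡_ (lookup (CS (length is))) →
                       ∀ j → lookup π (lookup (fromList is) (lookup (CS (length is)) j))
                               ≡ lookup (γ₂ᵈ S) (lookup (fromList is) j)
  cyclically-shifted {is} I₂≡is S≡CS CS-inj j =
    subst (λ τ → lookup π (lookup (fromList is) (lookup τ j)) ≡ lookup (γ₂ᵈ S) (lookup (fromList is) j)) S≡CS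
      (shifted I₂≡is (subst (λ τ → Injective _≡_ _≡_ (lookup τ)) (sym S≡CS) CS-inj) j)

  -- π b = γ₂(a) = γ₂(σ b) = b
  ¬backward-step : ∀ {a b} → lookup π b ≡ lookup (γ₂ᵈ S) a → lookup (S n) b ≡ a → ⊥
  ¬backward-step {a} {b} πb≡γ₂a σb≡a =
    derangement b (trans πb≡γ₂a (trans (cong (lookup (γ₂ᵈ S)) (sym σb≡a)) (γ₂ᵈ-inverse S σ-inj b)))

  I₂≢singleton : ∀ i → I₂ ≢ i ∷ []
  I₂≢singleton i I₂≡[i] = ∈I₂⇒mismatch (subst (i ∈_) (sym I₂≡[i]) (here refl))
    (sym (subst (λ k → lookup π k ≡ lookup (γ₂ᵈ S) i) (lookup-singleton (lookup (S 1) zero))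
      (shifted I₂≡[i] (λ { {zero} {zero} _ → refl }) zero)))
    where
    lookup-singleton : ∀ k → lookup (i ∷ []) k ≡ i
    lookup-singleton zero = refl

  I₂≢pair : S 2 ≡ CS 2 → ∀ x y → lookup (S n) y ≡ x ⊎ lookup (S n) x ≡ y → I₂ ≢ x ∷ y ∷ []
  I₂≢pair S₂≡CS₂ x y (inj₁ σy≡x) I₂≡xy =
    ¬backward-step (cyclically-shifted I₂≡xy S₂≡CS₂ CS₂-injective zero) σy≡x
  I₂≢pair S₂≡CS₂ x y (inj₂ σx≡y) I₂≡xy =
    ¬backward-step (cyclically-shifted I₂≡xy S₂≡CS₂ CS₂-injective (suc zero)) σx≡y

  I₂≢backwardTriple : S 3 ≡ CS 3 → (T : BackwardTriple (lookup (S n))) →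
                      let open BackwardTriple T in I₂ ≢ x ∷ y ∷ z ∷ []
  I₂≢backwardTriple S₃≡CS₃ T I₂≡xyz with BackwardTriple.backward T
  ... | inj₁ σy≡x        = ¬backward-step (cyclically-shifted I₂≡xyz S₃≡CS₃ CS₃-injective zero) σy≡x
  ... | inj₂ (inj₁ σz≡y) = ¬backward-step (cyclically-shifted I₂≡xyz S₃≡CS₃ CS₃-injective (suc zero)) σz≡y
  ... | inj₂ (inj₂ σx≡z) = ¬backward-step (cyclically-shifted I₂≡xyz S₃≡CS₃ CS₃-injective (suc (suc zero))) σx≡z

module Counting {n} (S : Strategy) (S-inductive : IsInductive n S) (4≤n : 4 ≤ n) (S≢CS : S n ≢ CS n) where

  σ : Fin n → Fin n
  σ = lookup (S n)

  σ-cyclic : IsCyclic (S n)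
  σ-cyclic = proj₂ S-inductive

  3≤n : 3 ≤ n
  3≤n = ℕ.≤-trans (ℕ.n≤1+n 3) 4≤n

  goods : List (Vec (Fin n) n)
  goods = filter (good? S) (allPerms n)

  wrong₂ : Vec (Fin n) n → List (Fin n)
  wrong₂ = I (γ₂ᵈ S)

  module Secret {π} (π∈goods : π ∈ goods) where
    open GoodSecret S (lookup-injective (S n) (proj₁ σ-cyclic)) {π}
      (proj₂ (∈.∈-filter⁻ (good? S) {xs = allPerms n} π∈goods)) public

  wrong₂-unique : Unique (map wrong₂ goods)
  wrong₂-unique =
    map⁺-injectiveOn wrong₂ (Unique.filter⁺ (good? S) (Unique.filter⁺ isPerm? (allVecs-unique n n))) λ π∈ τ∈ I₂π≡I₂τ →
      trans (Secret.π≡rearrange π∈) (trans (cong (rearrange S (γ₂ᵈ S)) I₂π≡I₂τ) (sym (Secret.π≡rearrange τ∈)))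

  edge : Fin n → List (Fin n)
  edge b with b Fin.<? σ b
  ... | yes _ = b ∷ σ b ∷ []
  ... | no  _ = σ b ∷ b ∷ []

  length-edge : ∀ b → length (edge b) ≡ 2
  length-edge b with b Fin.<? σ b
  ... | yes _ = refl
  ... | no  _ = refl

  edge-sorted : ∀ b → AllPairs Fin._<_ (edge b)
  edge-sorted b with b Fin.<? σ b
  ... | yes b<σb = (b<σb ∷ []) ∷ [] ∷ []
  ... | no  b≮σb = (Fin.≤∧≢⇒< (ℕ.≮⇒≥ b≮σb) (cyclic⇒no-fixpoint σ-cyclic 3≤n b) ∷ []) ∷ [] ∷ []

  edge-injective : ∀ {b c} → edge b ≡ edge c → b ≡ c
  edge-injective {b} {c} e with b Fin.<? σ b | c Fin.<? σ c
  ... | yes _ | yes _ = List.∷-injectiveˡ e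
  ... | no  _ | no  _ = List.∷-injectiveˡ (List.∷-injectiveʳ e)
  ... | yes _ | no  _ = ⊥-elim (cyclic⇒no-2-cycle σ-cyclic 3≤n c
                          (trans (cong σ (sym (List.∷-injectiveˡ e))) (List.∷-injectiveˡ (List.∷-injectiveʳ e))))
  ... | no  _ | yes _ = ⊥-elim (cyclic⇒no-2-cycle σ-cyclic 3≤n b
                          (trans (cong σ (List.∷-injectiveˡ e)) (sym (List.∷-injectiveˡ (List.∷-injectiveʳ e)))))

  edge-backward : ∀ b → ∃₂ λ x y → edge b ≡ x ∷ y ∷ [] × (σ y ≡ x ⊎ σ x ≡ y)
  edge-backward b with b Fin.<? σ b
  ... | yes _ = b , σ b , refl , inj₂ refl
  ... | no  _ = σ b , b , refl , inj₁ refl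

  I₂≢edge : ∀ {π} (π∈goods : π ∈ goods) b → wrong₂ π ≢ edge b
  I₂≢edge π∈ b I₂≡edge =
    let x , y , edge≡xy , backward = edge-backward b
    in Secret.I₂≢pair π∈ (proj₁ S-inductive 2 (s≤s z≤n) 3≤n) x y backward (trans I₂≡edge edge≡xy)

  T : BackwardTriple σ
  T = ≢CS⇒backwardTriple σ-cyclic 3≤n S≢CS
  open BackwardTriple T

  triple : List (Fin n)
  triple = x ∷ y ∷ z ∷ []

  short : List (List (Fin n))
  short = map (_∷ []) (positions n) ++ map edge (positions n)

  excluded : List (List (Fin n))
  excluded = [] ∷ triple ∷ positions n ∷ short

  length-short : length short ≡ n + n
  length-short = begin
    length short                                                    ≡⟨ List.length-++ (map (_∷ []) (positions n)) ⟩
    length (map (_∷ []) (positions n)) + length (map edge (positions n))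
      ≡⟨ cong₂ _+_ (List.length-map (_∷ []) (positions n)) (List.length-map edge (positions n)) ⟩
    length (positions n) + length (positions n)                      ≡⟨ cong (λ m → m + m) (length-positions n) ⟩
    n + n                                                           ∎
    where open ≡-Reasoning

  All-short : ∀ {P : List (Fin n) → Set} → (∀ i → P (i ∷ [])) → (∀ b → P (edge b)) → All P short
  All-short P[i] P-edge = All.++⁺ {xs = map (_∷ []) (positions n)}
    (All.map⁺ {f = _∷ []} (All.tabulate λ {i} _ → P[i] i)) (All.map⁺ {f = edge} (All.tabulate λ {b} _ → P-edge b))

  short-lengths : All (λ is → length is ≡ 1 ⊎ length is ≡ 2) short
  short-lengths = All-short (λ _ → inj₁ refl) (inj₂ ∘ length-edge)

  ≢short : ∀ {is} → length is ≢ 1 → length is ≢ 2 → All (is ≢_) short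
  ≢short l≢1 l≢2 = All.map (λ { (inj₁ l≡1) refl → l≢1 l≡1 ; (inj₂ l≡2) refl → l≢2 l≡2 }) short-lengths

  length-positions≢<4 : ∀ {m} → m < 4 → length (positions n) ≢ m
  length-positions≢<4 m<4 l≡m = ℕ.<-irrefl refl (ℕ.<-≤-trans (subst (_< 4) (trans (sym l≡m) (length-positions n)) m<4) 4≤n)

  -- The excluded lists have lengths 0, 3, n ≥ 4, and 1 (singletons) or 2 (edges).
  excluded-unique : Unique excluded
  excluded-unique =
    ((λ ()) ∷ (λ []≡all → length-positions≢<4 (s≤s z≤n) (cong length (sym []≡all))) ∷ ≢short (λ ()) (λ ())) ∷
    ((λ T≡all → length-positions≢<4 ℕ.≤-refl (cong length (sym T≡all))) ∷ ≢short (λ ()) (λ ())) ∷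
    ≢short (length-positions≢<4 (s≤s (s≤s z≤n))) (length-positions≢<4 (s≤s (s≤s (s≤s z≤n)))) ∷
    Unique.++⁺ (Unique.map⁺ List.∷-injectiveˡ (positions-unique n)) (Unique.map⁺ edge-injective (positions-unique n))
      λ (s∈ , e∈) → let i , _ , s≡[i] = ∈.∈-map⁻ (_∷ []) s∈ ; b , _ , s≡edge = ∈.∈-map⁻ edge e∈
                    in case trans (cong length (trans (sym s≡[i]) s≡edge)) (length-edge b) of λ ()

  excluded-sublists : All (_∈ sublists (positions n)) excluded
  excluded-sublists = All.map sorted⇒∈-sublists-positions
    ([] ∷ ((x<y ∷ Fin.<-trans x<y y<z ∷ []) ∷ (y<z ∷ []) ∷ [] ∷ []) ∷ positions-sorted n ∷
     All-short (λ _ → [] ∷ []) edge-sorted)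

  wrong₂-sublists : All (_∈ sublists (positions n)) (map wrong₂ goods)
  wrong₂-sublists = All.map⁺ {f = wrong₂}
    (All.tabulate λ {π} _ → ⊆⇒∈-sublists (filter-⊆ (∁? (matches? (γ₂ᵈ S) π)) (positions n)))

  wrong₂∉short : ∀ {π} → π ∈ goods → wrong₂ π ∉ short
  wrong₂∉short {π} π∈ I₂∈short = [ ∉singletons , ∉edges ]′ (∈.∈-++⁻ (map (_∷ []) (positions n)) I₂∈short)
    where
    ∉singletons : wrong₂ π ∉ map (_∷ []) (positions n)
    ∉singletons I₂∈ = let i , _ , I₂≡[i] = ∈.∈-map⁻ (_∷ []) I₂∈ in Secret.I₂≢singleton π∈ i I₂≡[i]
    ∉edges : wrong₂ π ∉ map edge (positions n)
    ∉edges I₂∈ = let b , _ , I₂≡edge = ∈.∈-map⁻ edge I₂∈ in I₂≢edge π∈ b I₂≡edge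

  wrong₂∉excluded : ∀ {π} → π ∈ goods → wrong₂ π ∉ excluded
  wrong₂∉excluded π∈ (here I₂≡[])                  = Secret.I₂≢[] π∈ I₂≡[]
  wrong₂∉excluded π∈ (there (here I₂≡T))           =
    Secret.I₂≢backwardTriple π∈ (proj₁ S-inductive 3 (s≤s z≤n) 4≤n) T I₂≡T
  wrong₂∉excluded π∈ (there (there (here I₂≡all))) = Secret.I₂≢positions π∈ I₂≡all
  wrong₂∉excluded π∈ (there (there (there I₂∈)))   = wrong₂∉short π∈ I₂∈

  count-bound : countGood n S + (3 + (n + n)) ≤ 2 ^ n
  count-bound = begin
    countGood n S + (3 + (n + n))              ≡⟨ cong₂ _+_ (List.length-map wrong₂ goods) (cong (3 +_) length-short) ⟨
    length (map wrong₂ goods) + length excluded ≡⟨ List.length-++ (map wrong₂ goods) ⟨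
    length (map wrong₂ goods ++ excluded)       ≤⟨ unique⇒length-≤ (Unique.++⁺ wrong₂-unique excluded-unique disjoint)
                                                                     (All.++⁺ wrong₂-sublists excluded-sublists) ⟩
    length (sublists (positions n))             ≡⟨ length-sublists (positions n) ⟩
    2 ^ length (positions n)                    ≡⟨ cong (2 ^_) (length-positions n) ⟩
    2 ^ n                                       ∎
    where
    open ℕ.≤-Reasoning
    disjoint : ∀ {is} → ¬ (is ∈ map wrong₂ goods × is ∈ excluded)
    disjoint (is∈ , is∈excluded) =
      let π , π∈ , is≡ = ∈.∈-map⁻ wrong₂ is∈ in wrong₂∉excluded π∈ (subst (_∈ excluded) is≡ is∈excluded)

+[2m+3]≤⇒<∸2m∸2 : ∀ c m p → c + (3 + (m + m)) ≤ p → c < p ∸ 2 * m ∸ 2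
+[2m+3]≤⇒<∸2m∸2 c m p bound =
  subst (suc c ≤_) (sym (ℕ.∸-+-assoc p (2 * m) 2)) (ℕ.m+n≤o⇒m≤o∸n (suc c) (subst (_≤ p) (rearranged c m) bound))
  where
  rearranged : ∀ c m → c + (3 + (m + m)) ≡ suc c + (2 * m + 2)
  rearranged = solve-∀

theorem4p8 : (n : ℕ) → 4 ≤ n → (S : Strategy) → IsInductive n S → ¬ (S n ≡ CS n) →
    countGood n S < 2 ^ n ∸ 2 * n ∸ 2
theorem4p8 n 4≤n S S-inductive S≢CS =
  +[2m+3]≤⇒<∸2m∸2 (countGood n S) n (2 ^ n) (Counting.count-bound S S-inductive 4≤n S≢CS)
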